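{- Let $n\ge1$. An element $d=d_1\cdots d_k\in\mathcal{D}(n)$ covers exactly those elements that can be obtained from $d$ by replacing some adjacent pair $d_i\,0$ (i.e. $d_{i+1}=0$) with $d_i>0$ by the pair $(d_i-1)\,2$.
   Context: Let $\beta(n)=b_1\cdots b_k$ be the binary expansion of $n$ ($b_1=1$ most significant). A hyperbinary expansion of $n$ is a word $d_1\cdots d_k$ of length $k$ over $\{0,1,2\}$ with $\sum_i d_i2^{k-i}=n$; it corresponds to the hyperbinary partition of $n$ (partition into powers of $2$, each part at most twice) in which $2^{k-i}$ has multiplicity $d_i$. $\mathcal{D}(n)$ is the set of hyperbinary expansions of $n$, ordered by transporting the refinement order on partitions ($\mu\le\lambda$ if the parts of $\lambda$ can be subdivided to produce the parts of $\mu$). -}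

module Defs where

open import Data.Nat using (ℕ; zero; suc; _+_; _*_; _^_; _≤_)
open import Data.Nat.Logarithm using (⌊log₂_⌋)
open import Data.List using (List; []; _∷_; _++_; length; replicate; concat)
open import Data.Nat.ListAction using (sum)
open import Data.List.Relation.Unary.All using (All)
open import Data.List.Relation.Binary.Pointwise using (Pointwise)
open import Data.List.Relation.Binary.Permutation.Propositional using (_↭_)
open import Data.Product using (Σ; _×_; ∃; ∃-syntax)
open import Relation.Binary.PropositionalEquality using (_≡_; _≢_)
open import Data.Empty using (⊥)

bitLength : ℕ → ℕ
bitLength n = suc ⌊log₂ n ⌋

value : List ℕ → ℕ
value []       = 0
value (d ∷ ds) = d * 2 ^ length ds + value ds

IsHyperbinary : ℕ → List ℕ → Set
IsHyperbinary n ds = length ds ≡ bitLength n × All (_≤ 2) ds × value ds ≡ n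

-- the corresponding partition (list of parts): 2^(k-i) with multiplicity dᵢ
parts : List ℕ → List ℕ
parts []       = []
parts (d ∷ ds) = replicate d (2 ^ length ds) ++ parts ds

-- refinement order on partitions: μ ≼ λ iff the parts of λ can be
-- subdivided to produce the parts of μ, i.e. the multiset μ splits into
-- blocks, one for each part of λ, each block summing to that part.
_≼_ : List ℕ → List ℕ → Set
μ ≼ λ′ = ∃[ blocks ] (Pointwise (λ b p → sum b ≡ p) blocks λ′ × concat blocks ↭ μ)

_≤ᴰ_ : List ℕ → List ℕ → Set
e ≤ᴰ d = parts e ≼ parts d

_<ᴰ_ : List ℕ → List ℕ → Set
e <ᴰ d = e ≤ᴰ d × e ≢ d

Covers : ℕ → List ℕ → List ℕ → Set
Covers n d e = e <ᴰ d × ((f : List ℕ) → IsHyperbinary n f → e <ᴰ f → f <ᴰ d → ⊥)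

Step : List ℕ → List ℕ → Set
Step d e = Σ (List ℕ) λ p → Σ ℕ λ a → Σ (List ℕ) λ s →
  (d ≡ p ++ suc a ∷ 0 ∷ s) × (e ≡ p ++ a ∷ 2 ∷ s)

{-# OPTIONS --safe #-}
-- Refining a partition can only lower, for every t, the total size of its parts
-- that are at least t.  For the partition of a hyperbinary word and t = 2^j this
-- total is 2^j times the value of the prefix above position j, so e ≤ᴰ d forces
-- every prefix of d to be worth at least the corresponding prefix of e.
-- Conversely, if d ≠ e dominates e in this sense, some step d → d′ (a positive
-- digit followed by 0 is lowered by one and the 0 becomes 2) keeps d′ dominating
-- e; a step splits one part into two halves, so iterating it refines d into e.
-- As each step adds exactly one part while e <ᴰ d forces e to have more parts
-- than d, d covers e exactly when e is one step below d.
module Submission where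

open import Defs
open import Data.Nat using (ℕ; zero; suc; _+_; _*_; _^_; _∸_; _≤_; _<_; z≤n; s≤s; z<s; _≤?_; _≟_)
open import Data.Nat.Properties
open import Data.Nat.ListAction using (sum)
open import Data.Nat.ListAction.Properties using (sum-++; sum-↭)
open import Data.Nat.Tactic.RingSolver using (solve-∀)
open import Data.List using (List; []; _∷_; _++_; length; replicate; concat; filter; map; [_])
open import Data.List.Properties using (length-++; concat-++; concat-map-[_]; ++-assoc; filter-++; filter-all; filter-none; filter-accept; filter-reject; ≡-dec)
open import Data.List.Relation.Unary.All using (All; []; _∷_)
import Data.List.Relation.Unary.All.Properties as All
open import Data.List.Relation.Binary.Pointwise as Pointwise using (Pointwise; []; _∷_)
open import Data.List.Relation.Binary.Permutation.Propositional using (_↭_; ↭-sym; ↭-reflexive; ↭-trans; module PermutationReasoning)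
import Data.List.Relation.Binary.Permutation.Propositional.Properties as ↭
open import Data.Product using (_×_; ∃-syntax; _,_)
open import Data.Sum using (_⊎_; inj₁; inj₂)
open import Function using (_∘_)
open import Function.Bundles using (_⇔_; mk⇔)
open import Relation.Nullary using (yes; no; ¬_; contradiction)
open import Relation.Binary.PropositionalEquality using (_≡_; _≢_; refl; sym; trans; cong; cong₂; subst; subst₂; module ≡-Reasoning)

tailMass : ℕ → List ℕ → ℕ
tailMass t xs = sum (filter (t ≤?_) xs)

tailMass-++ : ∀ t xs ys → tailMass t (xs ++ ys) ≡ tailMass t xs + tailMass t ys
tailMass-++ t xs ys = trans (cong sum (filter-++ (t ≤?_) xs ys)) (sum-++ (filter (t ≤?_) xs) _)

tailMass-↭ : ∀ t {xs ys} → xs ↭ ys → tailMass t xs ≡ tailMass t ys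
tailMass-↭ t = sum-↭ ∘ ↭.filter-↭ (t ≤?_)

tailMass-accept : ∀ {t x} xs → t ≤ x → tailMass t (x ∷ xs) ≡ x + tailMass t xs
tailMass-accept {t} xs t≤x = cong sum (filter-accept (t ≤?_) {xs = xs} t≤x)

tailMass-reject : ∀ {t x} xs → ¬ t ≤ x → tailMass t (x ∷ xs) ≡ tailMass t xs
tailMass-reject {t} xs t≰x = cong sum (filter-reject (t ≤?_) {xs = xs} t≰x)

tailMass≤sum : ∀ t xs → tailMass t xs ≤ sum xs
tailMass≤sum t [] = z≤n
tailMass≤sum t (x ∷ xs) with t ≤? x
... | yes t≤x = ≤-trans (≤-reflexive (tailMass-accept xs t≤x)) (+-monoʳ-≤ x (tailMass≤sum t xs))
... | no t≰x  = ≤-trans (≤-reflexive (tailMass-reject xs t≰x))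
                        (≤-trans (tailMass≤sum t xs) (m≤n+m (sum xs) x))

tailMass-< : ∀ t xs → sum xs < t → tailMass t xs ≡ 0
tailMass-< t [] _ = refl
tailMass-< t (x ∷ xs) xs<t with t ≤? x
... | yes t≤x = contradiction (≤-<-trans (≤-trans t≤x (m≤m+n x (sum xs))) xs<t) (<-irrefl refl)
... | no t≰x  = trans (tailMass-reject xs t≰x) (tailMass-< t xs (≤-<-trans (m≤n+m (sum xs) x) xs<t))

tailMass-merge : ∀ t xs → tailMass t xs ≤ tailMass t [ sum xs ]
tailMass-merge t xs with t ≤? sum xs
... | yes t≤xs = begin
  tailMass t xs        ≤⟨ tailMass≤sum t xs ⟩
  sum xs               ≡⟨ +-identityʳ (sum xs) ⟨
  sum xs + 0           ≡⟨ tailMass-accept [] t≤xs ⟨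
  tailMass t [ sum xs ] ∎
  where open ≤-Reasoning
... | no t≰xs = ≤-trans (≤-reflexive (tailMass-< t xs (≰⇒> t≰xs))) z≤n

≼⇒tailMass-≤ : ∀ {μ λ′} → μ ≼ λ′ → ∀ t → tailMass t μ ≤ tailMass t λ′
≼⇒tailMass-≤ {μ} {λ′} (bs , blocks , perm) t = begin
  tailMass t μ           ≡⟨ tailMass-↭ t (↭-sym perm) ⟩
  tailMass t (concat bs) ≤⟨ merged blocks ⟩
  tailMass t λ′          ∎
  where
  open ≤-Reasoning
  merged : ∀ {bs ps} → Pointwise (λ b p → sum b ≡ p) bs ps → tailMass t (concat bs) ≤ tailMass t ps
  merged [] = z≤n
  merged {b ∷ bs} {_ ∷ ps} (refl ∷ blocks) = begin
    tailMass t (b ++ concat bs)            ≡⟨ tailMass-++ t b (concat bs) ⟩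
    tailMass t b + tailMass t (concat bs)  ≤⟨ +-mono-≤ (tailMass-merge t b) (merged blocks) ⟩
    tailMass t [ sum b ] + tailMass t ps   ≡⟨ tailMass-++ t [ sum b ] ps ⟨
    tailMass t (sum b ∷ ps)                ∎

sum-replicate : ∀ k p → sum (replicate k p) ≡ k * p
sum-replicate zero    p = refl
sum-replicate (suc k) p = cong (p +_) (sum-replicate k p)

tailMass-replicate-≤ : ∀ {t p} k → t ≤ p → tailMass t (replicate k p) ≡ k * p
tailMass-replicate-≤ {t} {p} k t≤p =
  trans (cong sum (filter-all (t ≤?_) (All.replicate⁺ k t≤p))) (sum-replicate k p)

tailMass-replicate-> : ∀ {t p} k → p < t → tailMass t (replicate k p) ≡ 0
tailMass-replicate-> {t} k p<t = cong sum (filter-none (t ≤?_) (All.replicate⁺ k (<⇒≱ p<t)))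

tailMass-parts-∷ : ∀ {t m} b e → length e ≡ m → t ≤ 2 ^ m →
                   tailMass t (parts (b ∷ e)) ≡ b * 2 ^ m + tailMass t (parts e)
tailMass-parts-∷ {t} b e refl t≤ =
  trans (tailMass-++ t (replicate b _) (parts e))
        (cong (_+ tailMass t (parts e)) (tailMass-replicate-≤ b t≤))

tailMass-parts-≥ : ∀ {t} e → 2 ^ length e ≤ t → tailMass t (parts e) ≡ 0
tailMass-parts-≥ [] _ = refl
tailMass-parts-≥ {t} (b ∷ e) top≤t = begin
  tailMass t (replicate b P ++ parts e)
    ≡⟨ tailMass-++ t (replicate b P) (parts e) ⟩
  tailMass t (replicate b P) + tailMass t (parts e)
    ≡⟨ cong₂ _+_ (tailMass-replicate-> b P<t) (tailMass-parts-≥ e (<⇒≤ P<t)) ⟩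
  0 ∎
  where
  open ≡-Reasoning
  P : ℕ
  P = 2 ^ length e
  P<t : P < t
  P<t = <-≤-trans (^-monoʳ-< 2 ≤-refl (n<1+n (length e))) top≤t

value-∷ : ∀ {m} b e → length e ≡ m → value (b ∷ e) ≡ b * 2 ^ m + value e
value-∷ b e refl = refl

-- Reading d and e from the most significant digit, the running surplus of the
-- prefix of d over that of e stays nonnegative and ends at 0; x is the surplus
-- carried in, in units of 2 ^ length d.
data Dominates : ℕ → List ℕ → List ℕ → Set where
  []  : Dominates 0 [] []
  _∷_ : ∀ {x a b y d e} → b + y ≡ x + x + a → Dominates y d e → Dominates x (a ∷ d) (b ∷ e)

carry-in : ∀ x a P u → x * (2 * P) + (a * P + u) ≡ (x + x + a) * P + u
carry-in = solve-∀

*-+-split : ∀ {s} b y P v → b + y ≡ s → s * P + v ≡ b * P + (y * P + v)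
*-+-split b y P v refl = trans (cong (_+ v) (*-distribʳ-+ P b y)) (+-assoc (b * P) (y * P) v)

tailMass⇒Dominates : ∀ {m x d e} → length d ≡ m → length e ≡ m →
  (∀ t → t ≤ 2 ^ m → tailMass t (parts e) ≤ x * 2 ^ m + tailMass t (parts d)) →
  value e ≡ x * 2 ^ m + value d → Dominates x d e
tailMass⇒Dominates {x = zero}  {[]} {[]} refl _ _ _ = []
tailMass⇒Dominates {x = suc x} {[]} {[]} refl _ _ ()
tailMass⇒Dominates {x = x} {a ∷ d} {b ∷ e} refl le masses values =
  b+y≡s ∷ tailMass⇒Dominates refl |e|≡|d| masses′ values′
  where
  |e|≡|d| : length e ≡ length d
  |e|≡|d| = suc-injective le
  P s : ℕ
  P = 2 ^ length d
  s = x + x + a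
  massesAt : ∀ t → t ≤ P → b * P + tailMass t (parts e) ≤ s * P + tailMass t (parts d)
  massesAt t t≤P = subst₂ _≤_
    (tailMass-parts-∷ b e |e|≡|d| t≤P)
    (trans (cong (x * (2 * P) +_) (tailMass-parts-∷ a d refl t≤P)) (carry-in x a P _))
    (masses t (≤-trans t≤P (m≤n*m P 2)))
  -- at t = P only the leading digits carry tail mass
  b≤s : b ≤ s
  b≤s = *-cancelʳ-≤ b s P {{m^n≢0 2 (length d)}} (begin
    b * P                          ≡⟨ +-identityʳ (b * P) ⟨
    b * P + 0                      ≡⟨ cong (b * P +_) (tailMass-parts-≥ e 2^|e|≤P) ⟨
    b * P + tailMass P (parts e)   ≤⟨ massesAt P ≤-refl ⟩
    s * P + tailMass P (parts d)   ≡⟨ cong (s * P +_) (tailMass-parts-≥ d ≤-refl) ⟩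
    s * P + 0                      ≡⟨ +-identityʳ (s * P) ⟩
    s * P                          ∎)
    where
    open ≤-Reasoning
    2^|e|≤P : 2 ^ length e ≤ P
    2^|e|≤P = ≤-reflexive (cong (2 ^_) |e|≡|d|)
  y : ℕ
  y = s ∸ b
  b+y≡s : b + y ≡ s
  b+y≡s = m+[n∸m]≡n b≤s
  masses′ : ∀ t → t ≤ P → tailMass t (parts e) ≤ y * P + tailMass t (parts d)
  masses′ t t≤P = +-cancelˡ-≤ (b * P) _ _
    (≤-trans (massesAt t t≤P) (≤-reflexive (*-+-split b y P _ b+y≡s)))
  values′ : value e ≡ y * P + value d
  values′ = +-cancelˡ-≡ (b * P) _ _ (begin
    b * P + value e             ≡⟨ value-∷ b e |e|≡|d| ⟨
    value (b ∷ e)               ≡⟨ values ⟩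
    x * (2 * P) + value (a ∷ d) ≡⟨ carry-in x a P (value d) ⟩
    s * P + value d             ≡⟨ *-+-split b y P (value d) b+y≡s ⟩
    b * P + (y * P + value d)   ∎)
    where open ≡-Reasoning

≤ᴰ⇒Dominates : ∀ {n d e} → IsHyperbinary n d → IsHyperbinary n e → e ≤ᴰ d → Dominates 0 d e
≤ᴰ⇒Dominates (|d| , _ , value-d) (|e| , _ , value-e) e≤d =
  tailMass⇒Dominates |d| |e| (λ t _ → ≼⇒tailMass-≤ e≤d t) (trans value-e (sym value-d))

Dominates-sum : ∀ {x d e} → Dominates x d e → x + sum d ≤ sum e
Dominates-sum [] = z≤n
Dominates-sum {x} (_∷_ {a = a} {b} {y} {d} {e} b+y≡2x+a r) = begin
  x + (a + sum d)      ≤⟨ +-monoˡ-≤ (a + sum d) (m≤m+n x x) ⟩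
  x + x + (a + sum d)  ≡⟨ +-assoc (x + x) a (sum d) ⟨
  x + x + a + sum d    ≡⟨ cong (_+ sum d) b+y≡2x+a ⟨
  b + y + sum d        ≡⟨ +-assoc b y (sum d) ⟩
  b + (y + sum d)      ≤⟨ +-monoʳ-≤ b (Dominates-sum r) ⟩
  b + sum e            ∎
  where open ≤-Reasoning

Step-∷ : ∀ a {d d′} → Step d d′ → Step (a ∷ d) (a ∷ d′)
Step-∷ a (p , b , s , refl , refl) = a ∷ p , b , s , refl , refl

Step-sum : ∀ {d d′} → Step d d′ → sum d′ ≡ suc (sum d)
Step-sum (p , a , s , refl , refl) = begin
  sum (p ++ a ∷ 2 ∷ s)                ≡⟨ sum-++ p (a ∷ 2 ∷ s) ⟩
  sum p + (a + (2 + sum s))           ≡⟨ cong (sum p +_) (regroup a (sum s)) ⟩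
  sum p + suc (suc a + (0 + sum s))   ≡⟨ +-suc (sum p) _ ⟩
  suc (sum p + sum (suc a ∷ 0 ∷ s))   ≡⟨ cong suc (sum-++ p (suc a ∷ 0 ∷ s)) ⟨
  suc (sum (p ++ suc a ∷ 0 ∷ s))      ∎
  where
  open ≡-Reasoning
  regroup : ∀ a z → a + (2 + z) ≡ suc (suc a + (0 + z))
  regroup = solve-∀

value-++-cong : ∀ p {q q′} → length q ≡ length q′ → value q ≡ value q′ →
                value (p ++ q) ≡ value (p ++ q′)
value-++-cong []      _      values = values
value-++-cong (x ∷ p) |q|≡|q′| values = cong₂ (λ k v → x * 2 ^ k + v)
  (trans (length-++ p) (trans (cong (length p +_) |q|≡|q′|) (sym (length-++ p))))
  (value-++-cong p |q|≡|q′| values)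

Step-IsHyperbinary : ∀ {n d d′} → Step d d′ → IsHyperbinary n d → IsHyperbinary n d′
Step-IsHyperbinary (p , a , s , refl , refl) (|d| , d≤2 , value-d) with All.++⁻ p d≤2
... | p≤2 , a+1≤2 ∷ _ ∷ s≤2 =
  trans (length-++ p) (trans (sym (length-++ p)) |d|) ,
  All.++⁺ p≤2 (≤-trans (n≤1+n a) a+1≤2 ∷ ≤-refl ∷ s≤2) ,
  trans (value-++-cong p refl (carry a (2 ^ length s) (value s))) value-d
  where
  carry : ∀ a Q v → a * (2 * Q) + (2 * Q + v) ≡ suc a * (2 * Q) + (0 * Q + v)
  carry = solve-∀

StartsWithZero : List ℕ → Set
StartsWithZero d = ∃[ d₂ ] d ≡ 0 ∷ d₂

Dominates-borrow : ∀ {x a b y d e} → b + suc y ≡ x + x + a → Dominates (suc y) (0 ∷ d) e →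
  (∃[ d′ ] Step (a ∷ 0 ∷ d) d′ × Dominates x d′ (b ∷ e)) ⊎ (0 < x × StartsWithZero (a ∷ 0 ∷ d))
Dominates-borrow {zero}  {zero}  {b} {y} b+y≡0 _ =
  contradiction (trans (sym (+-suc b y)) b+y≡0) 1+n≢0
Dominates-borrow {suc _} {zero}  _ _ = inj₂ (z<s , _ , refl)
Dominates-borrow {x} {suc a} {b} {y} {d} b+y≡2x+a (c+z≡2y+2 ∷ r) =
  inj₁ (a ∷ 2 ∷ d , ([] , a , d , refl , refl) , lowered ∷ trans c+z≡2y+2 (raised y) ∷ r)
  where
  lowered : b + y ≡ x + x + a
  lowered = suc-injective (trans (sym (+-suc b y)) (trans b+y≡2x+a (+-suc (x + x) a)))
  raised : ∀ y → suc y + suc y + 0 ≡ y + y + 2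
  raised = solve-∀

[1+x]+[1+x]+a≤2⇒a≡0 : ∀ {x a} → suc x + suc x + a ≤ 2 → a ≡ 0
[1+x]+[1+x]+a≤2⇒a≡0 {x} {a} ≤2 = n≤0⇒n≡0 (+-cancelˡ-≤ 2 a 0
  (≤-trans (+-monoˡ-≤ a (+-mono-≤ (s≤s (z≤n {x})) (s≤s (z≤n {x})))) ≤2))

-- The second alternative says that the step has to be taken one position
-- further left, lowering the digit in front of d.
Dominates-step′ : ∀ {x d e} → Dominates x d e → All (_≤ 2) e → 0 < x ⊎ d ≢ e →
  (∃[ d′ ] Step d d′ × Dominates x d′ e) ⊎ (0 < x × StartsWithZero d)
Dominates-step′ [] _ (inj₁ ())
Dominates-step′ [] _ (inj₂ []≢[]) = contradiction refl []≢[]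
Dominates-step′ (_∷_ {y = suc y} b+y≡2x+a r) (_ ∷ e≤2) _ with Dominates-step′ r e≤2 (inj₁ z<s)
... | inj₁ (d′ , step , r′) = inj₁ (_ , Step-∷ _ step , b+y≡2x+a ∷ r′)
... | inj₂ (_ , _ , refl)   = Dominates-borrow b+y≡2x+a r
Dominates-step′ (_∷_ {y = zero} {d} {e} b+0≡2x+a r) (b≤2 ∷ e≤2) surplus with ≡-dec _≟_ d e
... | no d≢e with Dominates-step′ r e≤2 (inj₂ d≢e)
...   | inj₁ (d′ , step , r′) = inj₁ (_ , Step-∷ _ step , b+0≡2x+a ∷ r′)
...   | inj₂ (() , _)
Dominates-step′ (_∷_ {zero} {y = zero} b+0≡a r) _ (inj₁ ()) | yes refl
Dominates-step′ (_∷_ {zero} {y = zero} {d} b+0≡a r) _ (inj₂ a∷d≢b∷d) | yes refl =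
  contradiction (cong (_∷ d) (trans (sym b+0≡a) (+-identityʳ _))) a∷d≢b∷d
Dominates-step′ (_∷_ {suc x} {a} {y = zero} {d} b+0≡2x+a r) (b≤2 ∷ _) _ | yes refl =
  inj₂ (z<s , subst (λ a → StartsWithZero (a ∷ d)) (sym a≡0) (d , refl))
  where
  a≡0 : a ≡ 0
  a≡0 = [1+x]+[1+x]+a≤2⇒a≡0 (subst (_≤ 2) (trans (sym (+-identityʳ _)) b+0≡2x+a) b≤2)

Dominates-step : ∀ {d e} → Dominates 0 d e → All (_≤ 2) e → d ≢ e →
  ∃[ d′ ] Step d d′ × Dominates 0 d′ e
Dominates-step r e≤2 d≢e with Dominates-step′ r e≤2 (inj₂ d≢e)
... | inj₁ step   = step
... | inj₂ (() , _)

Dominates⇒sum-< : ∀ {d e} → Dominates 0 d e → All (_≤ 2) e → d ≢ e → sum d < sum e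
Dominates⇒sum-< r e≤2 d≢e with Dominates-step r e≤2 d≢e
... | _ , step , r′ = subst (_≤ _) (Step-sum step) (Dominates-sum r′)

Pointwise-++⁻ : ∀ {a b r} {A : Set a} {B : Set b} {R : A → B → Set r} xs {ys bs} →
  Pointwise R bs (xs ++ ys) →
  ∃[ bs₁ ] ∃[ bs₂ ] bs ≡ bs₁ ++ bs₂ × Pointwise R bs₁ xs × Pointwise R bs₂ ys
Pointwise-++⁻ [] rs = [] , _ , refl , [] , rs
Pointwise-++⁻ (x ∷ xs) (r ∷ rs) with Pointwise-++⁻ xs rs
... | bs₁ , bs₂ , refl , rs₁ , rs₂ = _ ∷ bs₁ , bs₂ , refl , r ∷ rs₁ , rs₂

≼-refl : ∀ xs → xs ≼ xs
≼-refl xs = map [_] xs , singletons xs , ↭-reflexive (concat-map-[ xs ])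
  where
  singletons : ∀ xs → Pointwise (λ b p → sum b ≡ p) (map [_] xs) xs
  singletons []       = []
  singletons (x ∷ xs) = +-identityʳ x ∷ singletons xs

≼-merge : ∀ {μ p q r zs} xs ys → p + q ≡ r → μ ≼ (xs ++ ys ++ p ∷ q ∷ zs) → μ ≼ (xs ++ r ∷ ys ++ zs)
≼-merge {r = r} xs ys p+q≡r (bs , blocks , perm) with Pointwise-++⁻ xs blocks
... | bsˣ , _ , refl , blocksˣ , blocks′ with Pointwise-++⁻ ys blocks′
... | bsʸ , bᵖ ∷ bᵠ ∷ bsᶻ , refl , blocksʸ , sumᵖ ∷ sumᵠ ∷ blocksᶻ =
  bsˣ ++ (bᵖ ++ bᵠ) ∷ bsʸ ++ bsᶻ ,
  Pointwise.++⁺ blocksˣ (merged ∷ Pointwise.++⁺ blocksʸ blocksᶻ) ,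
  ↭-trans regroup perm
  where
  merged : sum (bᵖ ++ bᵠ) ≡ r
  merged = trans (sum-++ bᵖ bᵠ) (trans (cong₂ _+_ sumᵖ sumᵠ) p+q≡r)
  open PermutationReasoning
  regroup : concat (bsˣ ++ (bᵖ ++ bᵠ) ∷ bsʸ ++ bsᶻ) ↭ concat (bsˣ ++ bsʸ ++ bᵖ ∷ bᵠ ∷ bsᶻ)
  regroup = begin
    concat (bsˣ ++ (bᵖ ++ bᵠ) ∷ bsʸ ++ bsᶻ)
      ≡⟨ concat-++ bsˣ _ ⟨
    concat bsˣ ++ (bᵖ ++ bᵠ) ++ concat (bsʸ ++ bsᶻ)
      ≡⟨ cong (λ zs → concat bsˣ ++ (bᵖ ++ bᵠ) ++ zs) (concat-++ bsʸ bsᶻ) ⟨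
    concat bsˣ ++ (bᵖ ++ bᵠ) ++ concat bsʸ ++ concat bsᶻ
      ↭⟨ ↭.++⁺ˡ (concat bsˣ) (↭.shifts (bᵖ ++ bᵠ) (concat bsʸ)) ⟩
    concat bsˣ ++ concat bsʸ ++ (bᵖ ++ bᵠ) ++ concat bsᶻ
      ≡⟨ cong (λ zs → concat bsˣ ++ concat bsʸ ++ zs) (++-assoc bᵖ bᵠ (concat bsᶻ)) ⟩
    concat bsˣ ++ concat bsʸ ++ concat (bᵖ ∷ bᵠ ∷ bsᶻ)
      ≡⟨ cong (concat bsˣ ++_) (concat-++ bsʸ _) ⟩
    concat bsˣ ++ concat (bsʸ ++ bᵖ ∷ bᵠ ∷ bsᶻ)
      ≡⟨ concat-++ bsˣ _ ⟩
    concat (bsˣ ++ bsʸ ++ bᵖ ∷ bᵠ ∷ bsᶻ) ∎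

partsShifted : ℕ → List ℕ → List ℕ
partsShifted k []       = []
partsShifted k (x ∷ xs) = replicate x (2 ^ (length xs + k)) ++ partsShifted k xs

parts-++ : ∀ p q → parts (p ++ q) ≡ partsShifted (length q) p ++ parts q
parts-++ []      q = refl
parts-++ (x ∷ p) q = begin
  replicate x (2 ^ length (p ++ q)) ++ parts (p ++ q)
    ≡⟨ cong₂ (λ k ps → replicate x (2 ^ k) ++ ps) (length-++ p) (parts-++ p q) ⟩
  replicate x (2 ^ (length p + length q)) ++ partsShifted (length q) p ++ parts q
    ≡⟨ ++-assoc (replicate x _) (partsShifted (length q) p) (parts q) ⟨
  (replicate x (2 ^ (length p + length q)) ++ partsShifted (length q) p) ++ parts q ∎
  where open ≡-Reasoning

≤ᴰ-trans-Step : ∀ {d d′ e} → Step d d′ → e ≤ᴰ d′ → e ≤ᴰ d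
≤ᴰ-trans-Step {e = e} (p , a , s , refl , refl) e≤d′ =
  subst (parts e ≼_) (sym (parts-++ p (suc a ∷ 0 ∷ s)))
    (≼-merge (partsShifted (2 + length s) p) (replicate a (2 ^ suc (length s))) halves
      (subst (parts e ≼_) (parts-++ p (a ∷ 2 ∷ s)) e≤d′))
  where
  halves : 2 ^ length s + 2 ^ length s ≡ 2 ^ suc (length s)
  halves = cong (2 ^ length s +_) (sym (+-identityʳ (2 ^ length s)))

Dominates⇒≤ᴰ : ∀ {d e} → Dominates 0 d e → All (_≤ 2) e → e ≤ᴰ d
Dominates⇒≤ᴰ {d} {e} r e≤2 = descend (sum e) (m≤m+n (sum e) (sum d)) r
  where
  descend : ∀ N {d} → sum e ≤ N + sum d → Dominates 0 d e → e ≤ᴰ d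
  descend N {d} bound r with ≡-dec _≟_ d e
  ... | yes refl = ≼-refl (parts d)
  descend zero    bound r | no d≢e = contradiction bound (<⇒≱ (Dominates⇒sum-< r e≤2 d≢e))
  descend (suc N) {d} bound r | no d≢e with Dominates-step r e≤2 d≢e
  ... | d′ , step , r′ =
    ≤ᴰ-trans-Step {e = e} step (descend N (≤-trans bound (≤-reflexive shift)) r′)
    where
    shift : suc N + sum d ≡ N + sum d′
    shift = trans (sym (+-suc N (sum d))) (cong (N +_) (sym (Step-sum step)))

Step⇒<ᴰ : ∀ {d d′} → Step d d′ → d′ <ᴰ d
Step⇒<ᴰ {d′ = d′} step =
  ≤ᴰ-trans-Step {e = d′} step (≼-refl (parts d′)) ,
  λ d′≡d → 1+n≢n (trans (sym (Step-sum step)) (cong sum d′≡d))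

<ᴰ⇒sum-< : ∀ {n d e} → IsHyperbinary n d → IsHyperbinary n e → e <ᴰ d → sum d < sum e
<ᴰ⇒sum-< hd he@(_ , e≤2 , _) (e≤d , e≢d) =
  Dominates⇒sum-< (≤ᴰ⇒Dominates hd he e≤d) e≤2 (e≢d ∘ sym)

lemma3p1 : (n : ℕ) → 1 ≤ n → (d e : List ℕ) → IsHyperbinary n d → IsHyperbinary n e →
    (Covers n d e ⇔ Step d e)
lemma3p1 n _ d e hd he@(_ , e≤2 , _) = mk⇔ covers⇒step step⇒covers
  where
  covers⇒step : Covers n d e → Step d e
  covers⇒step ((e≤d , e≢d) , nothing-between)
    with Dominates-step (≤ᴰ⇒Dominates hd he e≤d) e≤2 (e≢d ∘ sym)
  ... | d′ , step , r′ with ≡-dec _≟_ d′ e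
  ...   | yes refl = step
  ...   | no d′≢e  = contradiction (Step⇒<ᴰ step)
          (nothing-between d′ (Step-IsHyperbinary step hd) (Dominates⇒≤ᴰ r′ e≤2 , d′≢e ∘ sym))
  step⇒covers : Step d e → Covers n d e
  step⇒covers step = Step⇒<ᴰ step , λ f hf e<f f<d →
    <-irrefl (sym (Step-sum step)) (≤-<-trans (<ᴰ⇒sum-< hd hf f<d) (<ᴰ⇒sum-< hf he e<f))
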